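{- For every $n>0$ the following holds: if $\mathcal{M}^{\mathbb{A}_t}_n$ halts on input $n$ within $t$ steps for infinitely many $t$, then $\mathcal{M}^{\mathbb{A}}_n$ halts on input $n$.
   Context: Model. An additive BSS RAM has real registers $Z_1,Z_2,\ldots$ and finitely many index registers $I_1,\ldots,I_k$ (holding positive integers). Its program is a finite labelled list of instructions of the forms $Z_i:=Z_j+Z_k$, $Z_i:=Z_j-Z_k$, $Z_j:=c$ ($c$ a constant), "if $Z_j=0$ then goto $l_1$ else goto $l_2$", "if $Z_j\geq 0$ then goto $l_1$ else goto $l_2$", $Z_{I_j}:=Z_{I_k}$, $I_j:=1$, $I_j:=I_j+1$, "if $I_j=I_k$ then goto $l_1$ else goto $l_2$", together with halting/output. Inputs are tuples in $\mathbb{R}^\infty=\bigcup_{n\ge1}\mathbb{R}^n$, loaded into $Z_1,\ldots,Z_n$ with every index register set to $n$. $\mathsf{M}^1_{\rm add}$: machines using only constants $0,1$; $\mathsf{M}^{1,=}_{\rm add}$: only constants $0,1$ and only equality tests. For $\mathcal{O}\subseteq\mathbb{R}^\infty$, machines in $\mathsf{M}^1_{\rm add}(\mathcal{O})$ may additionally execute "if $(Z_1,\ldots,Z_{I_1})\in\mathcal{O}$ then goto $l_1$ else goto $l_2$". Numbering of oracle machines: for $\mathcal{O}\subseteq\mathbb{R}^\infty$ and $\mathcal{M}\in\mathsf{M}^1_{\rm add}(\mathcal{O})$ with binary program code $(c_1,\ldots,c_l)$ put $K_\mathcal{M}=2^l+\sum_{i=1}^lc_i2^{l-i}$ and $\mathcal{M}^{\mathcal{O}}_{K_\mathcal{M}}=\mathcal{M}$;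 for other $k$ let $\mathcal{M}^{\mathcal{O}}_k$ be a fixed always-halting machine (the same program is used for every oracle $\mathcal{O}$). The sets $\mathbb{A}_s$ and $\mathbb{A}$: let $\mathcal{N}_1,\mathcal{N}_2,\ldots$ be an effective list of all machines in $\mathsf{M}^{1,=}_{\rm add}$, $W_i$ the set of positive integers in the halting set of $\mathcal{N}_i$, $\bar{\mathcal N}_i\in\mathsf{M}^{1,=}_{\rm add}$ a machine enumerating $W_i$, and $W_{i,s}\subseteq W_i$ the set of positive integers enumerated by $\bar{\mathcal N}_i$ for the input $s$ within the first $s$ steps. $\mathbb{A}_1=\emptyset$. Given $\mathbb{A}_s$, for $j\le s$ let $a(j,s)$ be the greatest integer used in an oracle query by $\mathcal{M}^{\mathbb{A}_s}_j$ on input $j$ within the first $s$ steps if $\mathcal{M}^{\mathbb{A}_s}_j$ halts on $j$ within $s$ steps, and $0$ otherwise. $\phi(i,s,x)$ means $2i<x$ and $a(j,s)<x$ for all $j\le i$. $I_s=\{i\le s\mid\mathbb{A}_s\cap W_{i,s}=\emptyset,\ \exists x\in W_{i,s}\,\phi(i,s,x)\}$. If $I_s=\emptyset$, $\mathbb{A}_{s+1}=\mathbb{A}_s$; otherwise with $i_s=\min I_s$ and $x_{i_s}=\min\{x\in W_{i_s,s}\mid\phi(i_s,s,x)\}$, $\mathbb{A}_{s+1}=\mathbb{A}_s\cup\{x_{i_s}\}$. $\mathbb{A}=\bigcup_{s\ge1}\mathbb{A}_s$. -}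

module Defs where

open import Data.Nat using (ℕ; zero; suc; _*_; _⊔_; _≡ᵇ_; _<ᵇ_)
open import Data.Integer using (ℤ; +_; -[1+_]) renaming (_+_ to _+ℤ_; _-_ to _-ℤ_)
open import Data.Bool using (Bool; true; false; if_then_else_; _∧_; not)
open import Data.List using (List; []; _∷_; map; upTo; filterᵇ)
open import Data.Bool.ListAction using (all; any)
open import Data.Maybe using (Maybe; just; nothing)
open import Data.Product using (∃; _×_)
open import Relation.Binary.PropositionalEquality using (_≡_)

-- Additive BSS RAMs with constants 0,1 and an oracle instruction.
-- Registers hold integers: on inputs (n) with n ∈ ℕ, starting from
-- constants 0 and 1 with + and -, every real register value that can
-- occur is an integer, so ℤ-valued registers give exactly the runs in
-- question.
-- Labels are 0-based positions in the program list.

data Instr : Set where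
  add      : ℕ → ℕ → ℕ → Instr       -- Z_i := Z_j + Z_k
  sub      : ℕ → ℕ → ℕ → Instr       -- Z_i := Z_j - Z_k
  const    : ℕ → Bool → Instr        -- Z_j := 0 (false) / 1 (true)
  ifZero   : ℕ → ℕ → ℕ → Instr       -- if Z_j = 0 then goto l1 else goto l2
  ifNonneg : ℕ → ℕ → ℕ → Instr       -- if Z_j ≥ 0 then goto l1 else goto l2
  copy     : ℕ → ℕ → Instr           -- Z_{I_j} := Z_{I_k}
  idxOne   : ℕ → Instr               -- I_j := 1
  idxSuc   : ℕ → Instr               -- I_j := I_j + 1
  ifIdxEq  : ℕ → ℕ → ℕ → ℕ → Instr   -- if I_j = I_k then goto l1 else goto l2
  query    : ℕ → ℕ → Instr           -- if (Z_1,…,Z_{I_1}) ∈ O then goto l1 else goto l2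
  halt     : Instr

Program : Set
Program = List Instr

record Config : Set where
  constructor config
  field
    pc : ℕ
    Z  : ℕ → ℤ
    I  : ℕ → ℕ
open Config public

fetch : Program → ℕ → Maybe Instr
fetch []       _       = nothing
fetch (x ∷ xs) zero    = just x
fetch (x ∷ xs) (suc k) = fetch xs k

halted : Program → Config → Bool
halted P c with fetch P (pc c)
... | nothing   = true
... | just halt = true
... | just _    = false

upd : {A : Set} → (ℕ → A) → ℕ → A → (ℕ → A)
upd f i v j = if j ≡ᵇ i then v else f j

isZeroℤ : ℤ → Bool
isZeroℤ (+ zero)   = true
isZeroℤ (+ suc _)  = false
isZeroℤ -[1+ _ ]   = false

isNonnegℤ : ℤ → Bool
isNonnegℤ (+ _)    = true
isNonnegℤ -[1+ _ ] = false

-- An oracle O ⊆ ℕ⁺ ⊆ ℝ^∞ (as 1-tuples), given by its characteristic function.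
-- The query tuple (Z_1,…,Z_{I_1}) lies in O iff I_1 = 1 and Z_1 = x with O x.
queryAns : (ℕ → Bool) → Config → Bool
queryAns χ c with I c 1 ≡ᵇ 1 | Z c 1
... | true  | + x      = χ x
... | true  | -[1+ _ ] = false
... | false | _        = false

-- the integer used in an oracle query (the single entry of a 1-tuple
-- query with natural value; 0 otherwise)
queryVal : Config → ℕ
queryVal c with I c 1 ≡ᵇ 1 | Z c 1
... | true  | + x      = x
... | true  | -[1+ _ ] = zero
... | false | _        = zero

next : Config → Config
next c = record c { pc = suc (pc c) }

exec : (ℕ → Bool) → Instr → Config → Config
exec χ (add i j k)       c = record (next c) { Z = upd (Z c) i (Z c j +ℤ Z c k) }
exec χ (sub i j k)       c = record (next c) { Z = upd (Z c) i (Z c j -ℤ Z c k) }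
exec χ (const j b)       c = record (next c) { Z = upd (Z c) j (if b then + 1 else + 0) }
exec χ (ifZero j l₁ l₂)  c = record c { pc = if isZeroℤ (Z c j) then l₁ else l₂ }
exec χ (ifNonneg j l₁ l₂) c = record c { pc = if isNonnegℤ (Z c j) then l₁ else l₂ }
exec χ (copy j k)        c = record (next c) { Z = upd (Z c) (I c j) (Z c (I c k)) }
exec χ (idxOne j)        c = record (next c) { I = upd (I c) j 1 }
exec χ (idxSuc j)        c = record (next c) { I = upd (I c) j (suc (I c j)) }
exec χ (ifIdxEq j k l₁ l₂) c = record c { pc = if I c j ≡ᵇ I c k then l₁ else l₂ }
exec χ (query l₁ l₂)     c = record c { pc = if queryAns χ c then l₁ else l₂ }
exec χ halt              c = c

step : (ℕ → Bool) → Program → Config → Config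
step χ P c with fetch P (pc c)
... | nothing = c
... | just i  = exec χ i c

run : (ℕ → Bool) → Program → ℕ → Config → Config
run χ P zero    c = c
run χ P (suc t) c = run χ P t (step χ P c)

usedNow : Program → Config → ℕ
usedNow P c with fetch P (pc c)
... | just (query _ _) = queryVal c
... | _                = zero

useMax : (ℕ → Bool) → Program → ℕ → Config → ℕ
useMax χ P zero    c = zero
useMax χ P (suc t) c = usedNow P c ⊔ useMax χ P t (step χ P c)

init : ℕ → Config
init n = config zero (λ j → if j ≡ᵇ 1 then + n else + zero) (λ _ → 1)

haltsWithinᵇ : (ℕ → Bool) → Program → ℕ → ℕ → Bool
haltsWithinᵇ χ P t n = halted P (run χ P t (init n))

HaltsWithin : (ℕ → Bool) → Program → ℕ → ℕ → Set
HaltsWithin χ P t n = haltsWithinᵇ χ P t n ≡ true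

Halts : (ℕ → Bool) → Program → ℕ → Set
Halts χ P n = ∃ λ t → HaltsWithin χ P t n

memᵇ : ℕ → List ℕ → Bool
memᵇ x xs = any (λ y → x ≡ᵇ y) xs

oracleOf : List ℕ → (ℕ → Bool)
oracleOf xs x = memᵇ x xs

minList : List ℕ → Maybe ℕ
minList []       = nothing
minList (x ∷ xs) with minList xs
... | nothing = just x
... | just m  = just (if x <ᵇ m then x else m)

firstᵇ : (ℕ → Bool) → List ℕ → Maybe ℕ
firstᵇ p []       = nothing
firstᵇ p (x ∷ xs) = if p x then just x else firstᵇ p xs

oneTo : ℕ → List ℕ
oneTo n = map suc (upTo n)

isJust : {A : Set} → Maybe A → Bool
isJust (just _) = true
isJust nothing  = false

-- The construction of 𝔸_s and 𝔸, relative to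
--   prog : the numbering k ↦ program of M_k^O (same program for every O)
--   W    : W i s = the finite set W_{i,s}

module Construction (prog : ℕ → Program) (W : ℕ → ℕ → List ℕ) where

  a : List ℕ → ℕ → ℕ → ℕ
  a As j s = if haltsWithinᵇ (oracleOf As) (prog j) s j
               then useMax (oracleOf As) (prog j) s (init j)
               else zero

  φ : List ℕ → ℕ → ℕ → ℕ → Bool
  φ As i s x = (2 * i <ᵇ x) ∧ all (λ j → a As j s <ᵇ x) (oneTo i)

  cands : List ℕ → ℕ → ℕ → List ℕ
  cands As i s = filterᵇ (φ As i s) (W i s)

  inI : List ℕ → ℕ → ℕ → Bool
  inI As s i = all (λ x → not (memᵇ x As)) (W i s) ∧ isJust (minList (cands As i s))

  nextStage : ℕ → List ℕ → List ℕ
  nextStage s As with firstᵇ (inI As s) (oneTo s)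
  ... | nothing = As
  ... | just i with minList (cands As i s)
  ...   | nothing = As
  ...   | just x  = x ∷ As

  -- stage' k = 𝔸_{k+1}
  stage' : ℕ → List ℕ
  stage' zero    = []
  stage' (suc k) = nextStage (suc k) (stage' k)

  -- 𝔸_s for s ≥ 1 (𝔸_0 := 𝔸_1 = ∅ is a harmless convention)
  𝔸 : ℕ → List ℕ
  𝔸 zero    = []
  𝔸 (suc k) = stage' k

module Submission where

-- Let u be the use of a halting computation M_n^{𝔸_t}(n).  As long
-- as later stages 𝔸_s agree with 𝔸_t below u, the same computation is
-- still halting at stage s with use u, so every requirement i ≥ n must
-- put in numbers x > a(n,s) = u and cannot disturb it.  The only way the
-- computation can be injured is thus an action for some i < n, and such an
-- action satisfies requirement i for good, strictly decreasing the number
-- of pending requirements among 1,…,n.  Since 𝔸 agrees with some stage on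
-- every initial segment, a halting stage t that is never injured yields a
-- halting computation relative to 𝔸; otherwise we pass to a later halting
-- stage with fewer pending requirements, and well-founded induction on
-- that number ends the search.

open import Defs
open import Data.Nat using (ℕ; zero; suc; _<_; _≤_; _+_; _∸_; _⊔_; _≡ᵇ_; _<ᵇ_; _≤′_; ≤′-refl; ≤′-step; _≤?_; z≤n; s≤s)
open import Data.Nat.Properties
open import Data.Nat.Induction using (<-wellFounded)
open import Data.Bool using (Bool; true; false; T; not; if_then_else_)
open import Data.Bool.Properties using (T-≡; T-∧; T-not-≡)
open import Data.Bool.ListAction using (all)
open import Data.List using (List; []; _∷_)
open import Data.List.Membership.Propositional using (_∈_; _∉_)
open import Data.List.Membership.Propositional.Properties using (∈-map⁻; ∈-map⁺; ∈-upTo⁺; ∈-upTo⁻; ∈-filter⁻)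
open import Data.List.Relation.Binary.Subset.Propositional using (_⊆_)
open import Data.List.Relation.Unary.Any as Any using (here; there)
open import Data.List.Relation.Unary.Any.Properties using (any⁺; any⁻)
open import Data.List.Relation.Unary.All as All using ()
open import Data.List.Relation.Unary.All.Properties using (all⁺; all⁻)
open import Data.Maybe using (just; nothing)
open import Data.Integer using (+_; -[1+_])
open import Data.Product using (∃; _×_; _,_; proj₁; proj₂; map₁)
open import Data.Empty using (⊥-elim)
open import Data.Sum using (_⊎_; inj₁; inj₂)
open import Function using (_∘_; _on_)
open import Function.Bundles using (_⇔_; Equivalence)
open import Induction.WellFounded using (Acc; acc)
open import Relation.Binary.Construct.On using (wellFounded)
open import Relation.Binary.PropositionalEquality
open import Relation.Nullary using (¬_; yes; no; contradiction)
open import Relation.Nullary.Decidable using (T?)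

private
  variable
    χ χ₁ χ₂ χ₃ : ℕ → Bool
    P : Program
    c : Config
    n t s s' u v x i : ℕ
    xs : List ℕ

T⇒≡ : ∀ {b} → T b → b ≡ true
T⇒≡ = Equivalence.to T-≡

≡⇒T : ∀ {b} → b ≡ true → T b
≡⇒T = Equivalence.from T-≡

T-not⇒¬T : ∀ {b} → T (not b) → ¬ T b
T-not⇒¬T {false} _ ()

¬T⇒T-not : ∀ {b} → ¬ T b → T (not b)
¬T⇒T-not {true}  ¬b = ¬b _
¬T⇒T-not {false} _  = _

Agree : (ℕ → Bool) → (ℕ → Bool) → ℕ → Set
Agree χ₁ χ₂ u = ∀ x → x ≤ u → χ₁ x ≡ χ₂ x

agree-≤ : v ≤ u → Agree χ₁ χ₂ u → Agree χ₁ χ₂ v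
agree-≤ v≤u ag x x≤v = ag x (≤-trans x≤v v≤u)

agree-trans : Agree χ₁ χ₂ u → Agree χ₂ χ₃ u → Agree χ₁ χ₃ u
agree-trans ag₁ ag₂ x x≤u = trans (ag₁ x x≤u) (ag₂ x x≤u)

queryAns-agree : χ₁ (queryVal c) ≡ χ₂ (queryVal c) → queryAns χ₁ c ≡ queryAns χ₂ c
queryAns-agree {c = c} e with I c 1 ≡ᵇ 1 | Z c 1
... | true  | + _      = e
... | true  | -[1+ _ ] = refl
... | false | _        = refl

step-agree : Agree χ₁ χ₂ (usedNow P c) → step χ₁ P c ≡ step χ₂ P c
step-agree {P = P} {c = c} ag with fetch P (pc c)
... | nothing                  = refl
... | just (add _ _ _)         = refl
... | just (sub _ _ _)         = refl
... | just (const _ _)         = refl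
... | just (ifZero _ _ _)      = refl
... | just (ifNonneg _ _ _)    = refl
... | just (copy _ _)          = refl
... | just (idxOne _)          = refl
... | just (idxSuc _)          = refl
... | just (ifIdxEq _ _ _ _)   = refl
... | just halt                = refl
... | just (query l₁ l₂)       =
  cong (λ b → record c { pc = if b then l₁ else l₂ })
       (queryAns-agree {c = c} (ag (queryVal c) ≤-refl))

run-agree : ∀ t c → useMax χ₁ P t c ≤ u → Agree χ₁ χ₂ u → run χ₁ P t c ≡ run χ₂ P t c
run-agree zero    c _  _  = refl
run-agree {χ₁} {P} {u} {χ₂} (suc t) c le ag =
  trans (run-agree t (step χ₁ P c) (m⊔n≤o⇒n≤o (usedNow P c) _ le) ag)
        (cong (run χ₂ P t) (step-agree {P = P} {c = c} (agree-≤ (m⊔n≤o⇒m≤o (usedNow P c) _ le) ag)))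

useMax-agree : ∀ t c → useMax χ₁ P t c ≤ u → Agree χ₁ χ₂ u → useMax χ₁ P t c ≡ useMax χ₂ P t c
useMax-agree zero    c _  _  = refl
useMax-agree {χ₁} {P} {u} {χ₂} (suc t) c le ag =
  cong (usedNow P c ⊔_)
    (trans (useMax-agree t (step χ₁ P c) (m⊔n≤o⇒n≤o (usedNow P c) _ le) ag)
           (cong (useMax χ₂ P t) (step-agree {P = P} {c = c} (agree-≤ (m⊔n≤o⇒m≤o (usedNow P c) _ le) ag))))

halted-fixed : halted P c ≡ true → step χ P c ≡ c × usedNow P c ≡ 0
halted-fixed {P} {c} h with fetch P (pc c)
... | nothing   = refl , refl
... | just halt = refl , refl

run-halted : ∀ k → halted P c ≡ true → run χ P k c ≡ c
run-halted zero    h = refl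
run-halted {P} {c} {χ} (suc k) h =
  trans (cong (run χ P k) (proj₁ (halted-fixed {P = P} {c = c} h))) (run-halted k h)

useMax-halted : ∀ k → halted P c ≡ true → useMax χ P k c ≡ 0
useMax-halted zero    h = refl
useMax-halted {P} {c} {χ} (suc k) h =
  cong₂ _⊔_ (proj₂ (halted-fixed {P = P} {c = c} {χ = χ} h))
            (trans (cong (useMax χ P k) (proj₁ (halted-fixed {P = P} {c = c} h))) (useMax-halted k h))

run-+ : ∀ t k c → run χ P (t + k) c ≡ run χ P k (run χ P t c)
run-+ zero    k c = refl
run-+ {χ} {P} (suc t) k c = run-+ t k (step χ P c)

useMax-+ : ∀ t k c → useMax χ P (t + k) c ≡ useMax χ P t c ⊔ useMax χ P k (run χ P t c)
useMax-+ zero    k c = refl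
useMax-+ {χ} {P} (suc t) k c =
  trans (cong (usedNow P c ⊔_) (useMax-+ t k (step χ P c))) (sym (⊔-assoc (usedNow P c) _ _))

halts-later : t ≤ s → HaltsWithin χ P t n →
  HaltsWithin χ P s n × useMax χ P s (init n) ≡ useMax χ P t (init n)
halts-later {t} {s} {χ} {P} {n} t≤s h with s ∸ t | m+[n∸m]≡n t≤s
... | k | refl =
  trans (cong (halted P) (trans (run-+ t k (init n)) (run-halted k h))) h ,
  trans (useMax-+ t k (init n))
        (trans (cong (useMax χ P t (init n) ⊔_) (useMax-halted k h)) (⊔-identityʳ _))

halts-transfer : t ≤ s → HaltsWithin χ₁ P t n → Agree χ₁ χ₂ (useMax χ₁ P t (init n)) →
  HaltsWithin χ₂ P s n × useMax χ₂ P s (init n) ≡ useMax χ₁ P t (init n)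
halts-transfer {t} {s} {χ₁} {P} {n} {χ₂} t≤s h ag =
  proj₁ later ,
  trans (proj₂ later) (sym (useMax-agree t (init n) ≤-refl ag))
  where
  halts₂ : HaltsWithin χ₂ P t n
  halts₂ = trans (cong (halted P) (sym (run-agree t (init n) ≤-refl ag))) h
  later : HaltsWithin χ₂ P s n × useMax χ₂ P s (init n) ≡ useMax χ₂ P t (init n)
  later = halts-later t≤s halts₂

memᵇ⇒∈ : ∀ xs → T (memᵇ x xs) → x ∈ xs
memᵇ⇒∈ {x} xs m = Any.map (λ {y} → ≡ᵇ⇒≡ x y) (any⁻ (x ≡ᵇ_) xs m)

∈⇒memᵇ : x ∈ xs → T (memᵇ x xs)
∈⇒memᵇ {x} x∈ = any⁺ (x ≡ᵇ_) (Any.map (λ {y} → ≡⇒≡ᵇ x y) x∈)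

insert-above : u < x → Agree (oracleOf xs) (oracleOf (x ∷ xs)) u
insert-above {u} {x} u<x y y≤u with y ≡ᵇ x in e
... | false = refl
... | true  = contradiction (≡ᵇ⇒≡ y x (≡⇒T e)) (<⇒≢ (≤-<-trans y≤u u<x))

∈-oneTo⁺ : 1 ≤ i → i ≤ n → i ∈ oneTo n
∈-oneTo⁺ {suc i} _ i≤n = ∈-map⁺ suc (∈-upTo⁺ i≤n)

∈-oneTo⁻ : i ∈ oneTo n → 1 ≤ i × i ≤ n
∈-oneTo⁻ i∈ with ∈-map⁻ suc i∈
... | j , j∈ , refl = s≤s z≤n , ∈-upTo⁻ j∈

firstᵇ-sound : ∀ (p : ℕ → Bool) xs → firstᵇ p xs ≡ just i → i ∈ xs × T (p i)
firstᵇ-sound p (x ∷ xs) eq with p x in px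
firstᵇ-sound p (x ∷ xs) refl | true = here refl , ≡⇒T px
... | false = map₁ there (firstᵇ-sound p xs eq)

minList-∈ : ∀ xs → minList xs ≡ just x → x ∈ xs
minList-∈ (y ∷ xs) eq with minList xs in e
minList-∈ (y ∷ xs) refl | nothing = here refl
... | just m with y <ᵇ m
minList-∈ (y ∷ xs) refl | just m | true  = here refl
minList-∈ (y ∷ xs) refl | just m | false = there (minList-∈ xs e)

count : (ℕ → Bool) → List ℕ → ℕ
count f []       = 0
count f (x ∷ xs) = if f x then suc (count f xs) else count f xs

count-mono : ∀ {f g} xs → (∀ {x} → T (g x) → T (f x)) → count g xs ≤ count f xs
count-mono []       g⇒f = z≤n
count-mono {f} {g} (x ∷ xs) g⇒f with g x in gx | f x in fx
... | true  | true  = s≤s (count-mono xs g⇒f)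
... | true  | false = ⊥-elim (subst T fx (g⇒f (≡⇒T gx)))
... | false | true  = m≤n⇒m≤1+n (count-mono xs g⇒f)
... | false | false = count-mono xs g⇒f

count-strict : ∀ {f g} xs → (∀ {x} → T (g x) → T (f x)) →
  i ∈ xs → T (f i) → ¬ T (g i) → count g xs < count f xs
count-strict {f = f} {g} (x ∷ xs) g⇒f (here refl) fi ¬gi
  with g x in gx | f x in fx
... | true  | _     = ⊥-elim (¬gi _)
... | false | true  = s≤s (count-mono xs g⇒f)
... | false | false = ⊥-elim fi
count-strict {f = f} {g} (x ∷ xs) g⇒f (there i∈) fi ¬gi
  with g x in gx | f x in fx
... | true  | true  = s≤s (count-strict xs g⇒f i∈ fi ¬gi)
... | true  | false = ⊥-elim (subst T fx (g⇒f (≡⇒T gx)))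
... | false | true  = m≤n⇒m≤1+n (count-strict xs g⇒f i∈ fi ¬gi)
... | false | false = count-strict xs g⇒f i∈ fi ¬gi

Eventually : (ℕ → Set) → Set
Eventually Q = ∃ λ s₀ → ∀ s → s₀ ≤ s → Q s

eventually-∀< : {Q : ℕ → ℕ → Set} → (∀ x → Eventually (Q x)) →
  ∀ u → Eventually (λ s → ∀ x → x < u → Q x s)
eventually-∀< ev zero = 0 , λ _ _ _ ()
eventually-∀< ev (suc u) with eventually-∀< ev u | ev u
... | s₁ , q₁ | s₂ , q₂ = s₁ ⊔ s₂ , below
  where
  below : ∀ s → s₁ ⊔ s₂ ≤ s → ∀ x → x < suc u → _
  below s le x x<1+u with m<1+n⇒m<n∨m≡n x<1+u
  ... | inj₁ x<u  = q₁ s (m⊔n≤o⇒m≤o s₁ s₂ le) x x<u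
  ... | inj₂ refl = q₂ s (m⊔n≤o⇒n≤o s₁ s₂ le)

module Stages (prog : ℕ → Program) (W : ℕ → ℕ → List ℕ) where
  open Construction prog W

  data StageStep (s : ℕ) (As : List ℕ) : List ℕ → Set where
    idle : StageStep s As As
    act  : ∀ i x → i ∈ oneTo s → T (inI As s i) → x ∈ W i s → T (φ As i s x) →
           StageStep s As (x ∷ As)

  stageStep : ∀ s As → StageStep s As (nextStage s As)
  stageStep s As with firstᵇ (inI As s) (oneTo s) in e₁
  ... | nothing = idle
  ... | just i with minList (cands As i s) in e₂
  ...   | nothing = idle
  ...   | just x  = act i x (proj₁ chosen) (proj₂ chosen) (proj₁ candidate) (proj₂ candidate)
    where
    chosen : i ∈ oneTo s × T (inI As s i)
    chosen = firstᵇ-sound (inI As s) (oneTo s) e₁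
    candidate : x ∈ W i s × T (φ As i s x)
    candidate = ∈-filter⁻ (T? ∘ φ As i s) {xs = W i s} (minList-∈ (cands As i s) e₂)

  -- 𝔸_{s+1} is produced from 𝔸_s by stage s (also for s = 0, where
  -- nothing happens since I_0 = ∅).
  𝔸-suc : ∀ s → 𝔸 (suc s) ≡ nextStage s (𝔸 s)
  𝔸-suc zero    = refl
  𝔸-suc (suc s) = refl

  𝔸-grows : ∀ s → 𝔸 s ⊆ 𝔸 (suc s)
  𝔸-grows s {x} x∈ = grows (stageStep s (𝔸 s)) (𝔸-suc s)
    where
    grows : ∀ {As'} → StageStep s (𝔸 s) As' → 𝔸 (suc s) ≡ As' → x ∈ 𝔸 (suc s)
    grows idle eq = subst (x ∈_) (sym eq) x∈
    grows (act _ _ _ _ _ _) eq = subst (x ∈_) (sym eq) (there x∈)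

  𝔸-mono : s ≤ s' → 𝔸 s ⊆ 𝔸 s'
  𝔸-mono = grows ∘ ≤⇒≤′
    where
    grows : s ≤′ s' → 𝔸 s ⊆ 𝔸 s'
    grows ≤′-refl           = λ x∈ → x∈
    grows (≤′-step {s'} le) = 𝔸-grows s' ∘ grows le

module Requirements (prog : ℕ → Program) (W : ℕ → ℕ → List ℕ)
  (W-mono : ∀ i s x → x ∈ W i s → x ∈ W i (suc s)) where
  open Construction prog W
  open Stages prog W

  -- Requirement i is pending at stage s if W_{i,s} is disjoint from 𝔸_s
  -- (the first condition of i ∈ I_s).
  pending : ℕ → ℕ → Bool
  pending s i = all (λ x → not (memᵇ x (𝔸 s))) (W i s)

  pending⇒∉ : T (pending s i) → x ∈ W i s → x ∉ 𝔸 s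
  pending⇒∉ {s} {i} p x∈W x∈𝔸 =
    T-not⇒¬T (All.lookup (all⁺ _ (W i s) p) x∈W) (∈⇒memᵇ x∈𝔸)

  ∉⇒pending : (∀ {x} → x ∈ W i s → x ∉ 𝔸 s) → T (pending s i)
  ∉⇒pending {i} {s} disjoint =
    all⁻ _ (All.tabulate λ x∈W → ¬T⇒T-not (disjoint x∈W ∘ memᵇ⇒∈ (𝔸 s)))

  -- Once satisfied, a requirement stays satisfied (W_{i,s} and 𝔸_s grow).
  pending-anti : T (pending (suc s) i) → T (pending s i)
  pending-anti {s} p = ∉⇒pending λ x∈W x∈𝔸 → pending⇒∉ p (W-mono _ _ _ x∈W) (𝔸-grows s x∈𝔸)

  satisfied : x ∈ W i s → x ∈ 𝔸 (suc s) → ¬ T (pending (suc s) i)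
  satisfied x∈W x∈𝔸 p = pending⇒∉ p (W-mono _ _ _ x∈W) x∈𝔸

  pendingCount : ℕ → ℕ → ℕ
  pendingCount n s = count (pending s) (oneTo n)

  pendingCount-anti : s ≤ s' → pendingCount n s' ≤ pendingCount n s
  pendingCount-anti {n = n} = decreases ∘ ≤⇒≤′
    where
    decreases : s ≤′ s' → pendingCount n s' ≤ pendingCount n s
    decreases ≤′-refl      = ≤-refl
    decreases (≤′-step le) = ≤-trans (count-mono (oneTo n) pending-anti) (decreases le)

module Halting (prog : ℕ → Program) (W : ℕ → ℕ → List ℕ)
  (W-mono : ∀ i s x → x ∈ W i s → x ∈ W i (suc s)) (n : ℕ) (n>0 : 0 < n) where
  open Construction prog W
  open Stages prog W
  open Requirements prog W W-mono

  O : ℕ → ℕ → Bool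
  O s = oracleOf (𝔸 s)

  use : ℕ → ℕ
  use s = useMax (O s) (prog n) s (init n)

  μ : ℕ → ℕ
  μ = pendingCount n

  μ-anti : s ≤ s' → μ s' ≤ μ s
  μ-anti = pendingCount-anti {n = n}

  -- If M_n^{𝔸_s}(n) halts within s steps, then a(n,s) is its use, so an
  -- action for a requirement i ≥ n puts in a number above the use.
  action-above-use : HaltsWithin (O s) (prog n) s n → n ≤ i → T (φ (𝔸 s) i s x) → use s < x
  action-above-use {s} {i} {x} h n≤i φx =
    <ᵇ⇒< (use s) x (subst (λ v → T (v <ᵇ x)) a≡use (All.lookup a<x (∈-oneTo⁺ n>0 n≤i)))
    where
    a<x : All.All (λ j → T (a (𝔸 s) j s <ᵇ x)) (oneTo i)
    a<x = all⁺ _ (oneTo i) (proj₂ (Equivalence.to T-∧ φx))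
    a≡use : a (𝔸 s) n s ≡ use s
    a≡use rewrite h = refl

  -- Injury analysis of one stage: a halted computation M_n^{𝔸_s}(n) is
  -- either left intact below its use, or some requirement i < n becomes
  -- satisfied, so fewer requirements are pending.
  injury : ∀ s → HaltsWithin (O s) (prog n) s n → Agree (O s) (O (suc s)) (use s) ⊎ μ (suc s) < μ s
  injury s h = by-step (stageStep s (𝔸 s)) (𝔸-suc s)
    where
    by-step : ∀ {As} → StageStep s (𝔸 s) As → 𝔸 (suc s) ≡ As →
              Agree (O s) (O (suc s)) (use s) ⊎ μ (suc s) < μ s
    by-step idle eq = inj₁ λ x _ → cong (memᵇ x) (sym eq)
    by-step (act i x i∈ inIᵢ x∈W φx) eq with n ≤? i
    ... | yes n≤i = inj₁ (subst (λ As → Agree (O s) (oracleOf As) (use s)) (sym eq)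
                            (insert-above {xs = 𝔸 s} (action-above-use {s = s} h n≤i φx)))
    ... | no  n≰i = inj₂ (count-strict (oneTo n) pending-anti
                            (∈-oneTo⁺ (proj₁ (∈-oneTo⁻ i∈)) (<⇒≤ (≰⇒> n≰i)))
                            (proj₁ (Equivalence.to T-∧ inIᵢ))
                            (satisfied x∈W (subst (x ∈_) (sym eq) (here refl))))

  stable : ∀ t → HaltsWithin (O t) (prog n) t n → ∀ s → t ≤ s →
           Agree (O t) (O s) (use t) ⊎ μ s < μ t
  stable t h s t≤s = from (≤⇒≤′ t≤s)
    where
    from : ∀ {s} → t ≤′ s → Agree (O t) (O s) (use t) ⊎ μ s < μ t
    from ≤′-refl = inj₁ λ _ _ → refl
    from (≤′-step {s} t≤′s) with from t≤′s
    ... | inj₂ drop = inj₂ (≤-<-trans (μ-anti (n≤1+n s)) drop)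
    ... | inj₁ ag with halts-transfer (≤′⇒≤ t≤′s) h ag
    ...   | hs , use≡ with injury s hs
    ...     | inj₁ ag′ = inj₁ (agree-trans ag (subst (Agree (O s) (O (suc s))) use≡ ag′))
    ...     | inj₂ drop = inj₂ (<-≤-trans drop (μ-anti (≤′⇒≤ t≤′s)))

  module _ (χ : ℕ → Bool) (χ⇔ : ∀ x → (χ x ≡ true) ⇔ (∃ λ s → x ∈ 𝔸 s))
    (often : ∀ m → ∃ λ t → m ≤ t × HaltsWithin (O t) (prog n) t n) where

    converges-at : ∀ x → Eventually (λ s → O s x ≡ χ x)
    converges-at x with χ x in e
    ... | true with Equivalence.to (χ⇔ x) e
    ...   | s₀ , x∈ = s₀ , λ s le → T⇒≡ (∈⇒memᵇ (𝔸-mono le x∈))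
    converges-at x | false = 0 , λ s _ → Equivalence.to T-not-≡ (¬T⇒T-not (∉𝔸 s ∘ memᵇ⇒∈ (𝔸 s)))
      where
      ∉𝔸 : ∀ s → x ∉ 𝔸 s
      ∉𝔸 s x∈ with () ← trans (sym e) (Equivalence.from (χ⇔ x) (s , x∈))

    converges-below : ∀ u → Eventually (λ s → Agree (O s) χ u)
    converges-below u with eventually-∀< converges-at (suc u)
    ... | s₀ , agree = s₀ , λ s le x x≤u → agree s le x (s≤s x≤u)

    _≺_ : ℕ → ℕ → Set
    _≺_ = _<_ on μ

    -- A halting stage t yields halting relative to χ: from some s ≥ t on,
    -- 𝔸_s agrees with χ below the use of stage t.  If 𝔸_s also agrees with
    -- 𝔸_t there, the use principle transfers the computation to χ;
    -- otherwise μ s < μ t and a later halting stage continues the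
    -- well-founded induction.
    halts-from : ∀ t → Acc _≺_ t → HaltsWithin (O t) (prog n) t n → Halts χ (prog n) n
    halts-from t (acc rs) h with converges-below (use t)
    ... | s₀ , agree-χ with stable t h (t ⊔ s₀) (m≤m⊔n t s₀)
    ...   | inj₁ ag = t , proj₁ (halts-transfer {P = prog n} {n = n} {χ₂ = χ} (≤-refl {t}) h
                              (agree-trans ag (agree-χ (t ⊔ s₀) (m≤n⊔m t s₀))))
    ...   | inj₂ drop with often (t ⊔ s₀)
    ...     | t′ , le , h′ = halts-from t′ (rs (≤-<-trans (μ-anti le) drop)) h′

lemma3p8 : (prog : ℕ → Program) (W : ℕ → ℕ → List ℕ)
    → (∀ i s x → x ∈ W i s → x ∈ W i (suc s))
    → ∀ n → 0 < n
    → (∀ m → ∃ λ t → m ≤ t × HaltsWithin (oracleOf (Construction.𝔸 prog W t)) (prog n) t n)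
    → (χ : ℕ → Bool) → (∀ x → (χ x ≡ true) ⇔ (∃ λ s → x ∈ Construction.𝔸 prog W s))
    → Halts χ (prog n) n
lemma3p8 prog W W-mono n n>0 often χ χ⇔ with often 0
... | t , _ , h = halts-from χ χ⇔ often t (wellFounded μ <-wellFounded t) h
  where open Halting prog W W-mono n n>0
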